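{- Let $m$ be a nonnegative integer and let $F_m$ be the lattice defined, within the variety $\mathcal{N}_5$, by generators $a_0,\dots,a_m,b_0,\dots,b_m,c,d$ and relations $a_0\leq\cdots\leq a_m$, $b_0\leq\cdots\leq b_m$, $c\wedge d\leq a_0\vee b_0$, and $(c\vee a_k\vee b_k)\wedge(d\vee a_k\vee b_k)\leq a_{k+1}\vee b_{k+1}$ whenever $0\leq k<m$. Then there is no $f\in F_m$ satisfying $(f\vee c)\wedge(f\vee d)=(f\wedge a_m)\vee(f\wedge b_m)$.
   Context: $\mathcal{N}_5$ is the lattice variety generated by the five-element nonmodular lattice (pentagon) $\mathsf{N}_5$. "The lattice defined within $\mathcal{N}_5$ by generators and relations" means the lattice in $\mathcal{N}_5$ generated by the given elements satisfying the relations, with the universal property that any assignment of the generators into a lattice of $\mathcal{N}_5$ satisfying the relations extends to a lattice homomorphism. -}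

module Defs where

open import Level using (0ℓ)
open import Data.Nat using (ℕ; suc)
open import Data.Fin using (Fin; inject₁; fromℕ; zero)
  renaming (suc to fsuc)
open import Relation.Binary.PropositionalEquality using (_≡_)
open import Algebra.Lattice.Bundles using (Lattice)

infixr 7 _∧ᵗ_
infixr 6 _∨ᵗ_

data Term (X : Set) : Set where
  var   : X → Term X
  _∨ᵗ_  : Term X → Term X → Term X
  _∧ᵗ_  : Term X → Term X → Term X

eval : {X : Set} (L : Lattice 0ℓ 0ℓ) → (X → Lattice.Carrier L) → Term X → Lattice.Carrier L
eval L ρ (var x)  = ρ x
eval L ρ (s ∨ᵗ t) = Lattice._∨_ L (eval L ρ s) (eval L ρ t)
eval L ρ (s ∧ᵗ t) = Lattice._∧_ L (eval L ρ s) (eval L ρ t)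

Leq : (L : Lattice 0ℓ 0ℓ) → Lattice.Carrier L → Lattice.Carrier L → Set
Leq L u v = Lattice._≈_ L (Lattice._∨_ L u v) v

-- The pentagon N5:  o < x < y < i,  o < z < i,  z incomparable to x, y

data N5 : Set where
  o x y z i : N5

_⊔₅_ : N5 → N5 → N5
o ⊔₅ q = q
p ⊔₅ o = p
i ⊔₅ q = i
p ⊔₅ i = i
x ⊔₅ x = x
x ⊔₅ y = y
y ⊔₅ x = y
y ⊔₅ y = y
z ⊔₅ z = z
p ⊔₅ q = i

_⊓₅_ : N5 → N5 → N5
i ⊓₅ q = q
p ⊓₅ i = p
o ⊓₅ q = o
p ⊓₅ o = o
x ⊓₅ x = x
x ⊓₅ y = x
y ⊓₅ x = x
y ⊓₅ y = y
z ⊓₅ z = z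
p ⊓₅ q = o

evalN5 : {n : ℕ} → (Fin n → N5) → Term (Fin n) → N5
evalN5 ρ (var v)  = ρ v
evalN5 ρ (s ∨ᵗ t) = evalN5 ρ s ⊔₅ evalN5 ρ t
evalN5 ρ (s ∧ᵗ t) = evalN5 ρ s ⊓₅ evalN5 ρ t

-- A lattice belongs to the variety 𝒩₅ generated by N5 iff it satisfies every
-- lattice identity valid in N5 (Birkhoff's HSP theorem).
InN5 : Lattice 0ℓ 0ℓ → Set
InN5 L = (n : ℕ) (s t : Term (Fin n)) →
         ((ρ : Fin n → N5) → evalN5 ρ s ≡ evalN5 ρ t) →
         (ρ : Fin n → Lattice.Carrier L) → Lattice._≈_ L (eval L ρ s) (eval L ρ t)

data Gen (m : ℕ) : Set where
  a : Fin (suc m) → Gen m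
  b : Fin (suc m) → Gen m
  c : Gen m
  d : Gen m

Relations : (m : ℕ) (L : Lattice 0ℓ 0ℓ) → (Gen m → Lattice.Carrier L) → Set
Relations m L g =
  ((k : Fin m) → Leq L (g (a (inject₁ k))) (g (a (fsuc k)))) ×'
  ((k : Fin m) → Leq L (g (b (inject₁ k))) (g (b (fsuc k)))) ×'
  Leq L (g c ∧ g d) (g (a zero) ∨ g (b zero)) ×'
  ((k : Fin m) → Leq L
     (((g c ∨ g (a (inject₁ k))) ∨ g (b (inject₁ k))) ∧ ((g d ∨ g (a (inject₁ k))) ∨ g (b (inject₁ k))))
     (g (a (fsuc k)) ∨ g (b (fsuc k))))
  where
  open Lattice L using (_∨_; _∧_)
  open import Data.Product using () renaming (_×_ to _×'_)

-- Equality of two elements (given as terms in the generators) in F_m: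
-- by the universal property, s = t in F_m iff s and t evaluate equally under
-- every relation-satisfying assignment into every lattice of 𝒩₅.
EqInF : (m : ℕ) → Term (Gen m) → Term (Gen m) → Set₁
EqInF m s t = (L : Lattice 0ℓ 0ℓ) → InN5 L → (g : Gen m → Lattice.Carrier L) →
              Relations m L g → Lattice._≈_ L (eval L g s) (eval L g t)

module Submission where

-- Everything happens in the pentagon N5 itself, which lies in 𝒩₅.
-- If f solved (f ∨ c) ∧ (f ∨ d) = (f ∧ aₘ) ∨ (f ∧ bₘ) in Fₘ, then for every
-- assignment g of the generators into N5 satisfying the defining relations,
-- the value s = f(g) would satisfy the same equation in N5 ("Balanced").
-- We use "threshold" assignments: the value of aₙ, bₙ depends only on the
-- position of n relative to a threshold k (below, at, or above it).  Each is
-- used on two sides: as is, and with a ↔ b, c ↔ d swapped (the relations and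
-- the equation are invariant under this swap).
--   * T k sends aₙ to x for n ≥ k (else o), all bₙ to o, c to x, d to o;
--     for k = m+1 the equation forces f(T k) = o.
--   * S k is a richer assignment whose images under the two lattice
--     homomorphisms χz, χx : N5 → {o < x} are T (k+1) (with sides swapped)
--     and T k.  The equation at S k forces f(S k) = o once χz(f(S k)) = o,
--     so f(T (k+1)) = o on both sides gives f(T k) = o on both sides.
--   * A constant assignment G forces f(G) = i, while χz ∘ G is T 0 with
--     sides swapped, so f(T 0) = χz i = x on that side: a contradiction.

open import Defs
open import Level using (0ℓ)
open import Data.Nat using (ℕ; zero; suc; _+_; _≤_; _<_; z≤n; s≤s)
open import Data.Nat.Properties using (+-suc; m≤n+m; suc-injective; +-identityʳ; n<1+n)
open import Data.Fin using (Fin; fromℕ; toℕ; inject₁) renaming (zero to fzero; suc to fsuc)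
open import Data.Fin.Properties using (toℕ-inject₁; toℕ-fromℕ; all?) renaming (_≟_ to _≟ᶠ_)
open import Data.Product using (_,_; _×_; proj₁; proj₂)
open import Function using (_∘_)
open import Relation.Nullary using (¬_)
open import Relation.Nullary.Decidable using (Dec; map′; from-yes)
open import Relation.Unary using (Pred; Decidable)
open import Relation.Binary.Definitions using (DecidableEquality)
open import Relation.Binary.PropositionalEquality
open import Algebra.Lattice.Bundles using (Lattice)
open import Algebra.Morphism.Definitions N5 N5 _≡_ using (Homomorphic₂)

-- Finite checks in N5: N5 is enumerated by Fin 5, so equality and universally
-- quantified decidable statements about N5 are decidable.

encode : N5 → Fin 5
encode o = fzero
encode x = fsuc fzero
encode y = fsuc (fsuc fzero)
encode z = fsuc (fsuc (fsuc fzero))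
encode i = fsuc (fsuc (fsuc (fsuc fzero)))

decode : Fin 5 → N5
decode fzero = o
decode (fsuc fzero) = x
decode (fsuc (fsuc fzero)) = y
decode (fsuc (fsuc (fsuc fzero))) = z
decode (fsuc (fsuc (fsuc (fsuc fzero)))) = i

decode-encode : ∀ p → decode (encode p) ≡ p
decode-encode o = refl
decode-encode x = refl
decode-encode y = refl
decode-encode z = refl
decode-encode i = refl

infix 4 _≟₅_
_≟₅_ : DecidableEquality N5
p ≟₅ q = map′ encode-injective (cong encode) (encode p ≟ᶠ encode q)
  where
  encode-injective : encode p ≡ encode q → p ≡ q
  encode-injective e = trans (sym (decode-encode p)) (trans (cong decode e) (decode-encode q))

∀₅? : {P : Pred N5 0ℓ} → Decidable P → Dec (∀ p → P p)
∀₅? {P} P? = map′ (λ h p → subst P (decode-encode p) (h (encode p)))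
                  (λ h k → h (decode k))
                  (all? (P? ∘ decode))

⊔-comm₅ : ∀ p q → (p ⊔₅ q) ≡ (q ⊔₅ p)
⊔-comm₅ = from-yes (∀₅? λ p → ∀₅? λ q → (p ⊔₅ q) ≟₅ (q ⊔₅ p))

⊓-comm₅ : ∀ p q → (p ⊓₅ q) ≡ (q ⊓₅ p)
⊓-comm₅ = from-yes (∀₅? λ p → ∀₅? λ q → (p ⊓₅ q) ≟₅ (q ⊓₅ p))

⊔-assoc₅ : ∀ p q r → ((p ⊔₅ q) ⊔₅ r) ≡ (p ⊔₅ (q ⊔₅ r))
⊔-assoc₅ = from-yes (∀₅? λ p → ∀₅? λ q → ∀₅? λ r → ((p ⊔₅ q) ⊔₅ r) ≟₅ (p ⊔₅ (q ⊔₅ r)))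

⊓-assoc₅ : ∀ p q r → ((p ⊓₅ q) ⊓₅ r) ≡ (p ⊓₅ (q ⊓₅ r))
⊓-assoc₅ = from-yes (∀₅? λ p → ∀₅? λ q → ∀₅? λ r → ((p ⊓₅ q) ⊓₅ r) ≟₅ (p ⊓₅ (q ⊓₅ r)))

⊔-absorbs-⊓₅ : ∀ p q → (p ⊔₅ (p ⊓₅ q)) ≡ p
⊔-absorbs-⊓₅ = from-yes (∀₅? λ p → ∀₅? λ q → (p ⊔₅ (p ⊓₅ q)) ≟₅ p)

⊓-absorbs-⊔₅ : ∀ p q → (p ⊓₅ (p ⊔₅ q)) ≡ p
⊓-absorbs-⊔₅ = from-yes (∀₅? λ p → ∀₅? λ q → (p ⊓₅ (p ⊔₅ q)) ≟₅ p)

⊔-swapʳ₅ : ∀ p q r → ((p ⊔₅ q) ⊔₅ r) ≡ ((p ⊔₅ r) ⊔₅ q)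
⊔-swapʳ₅ = from-yes (∀₅? λ p → ∀₅? λ q → ∀₅? λ r → ((p ⊔₅ q) ⊔₅ r) ≟₅ ((p ⊔₅ r) ⊔₅ q))

pentagon : Lattice 0ℓ 0ℓ
pentagon = record
  { Carrier = N5 ; _≈_ = _≡_ ; _∨_ = _⊔₅_ ; _∧_ = _⊓₅_
  ; isLattice = record
    { isEquivalence = isEquivalence
    ; ∨-comm = ⊔-comm₅ ; ∨-assoc = ⊔-assoc₅ ; ∨-cong = cong₂ _⊔₅_
    ; ∧-comm = ⊓-comm₅ ; ∧-assoc = ⊓-assoc₅ ; ∧-cong = cong₂ _⊓₅_
    ; absorptive = ⊔-absorbs-⊓₅ , ⊓-absorbs-⊔₅ } }

_≤₅_ : N5 → N5 → Set
p ≤₅ q = (p ⊔₅ q) ≡ q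

pentagon∈𝒩₅ : InN5 pentagon
pentagon∈𝒩₅ n s t s≡t ρ = trans (eval≡evalN5 s) (trans (s≡t ρ) (sym (eval≡evalN5 t)))
  where
  eval≡evalN5 : ∀ u → eval pentagon ρ u ≡ evalN5 ρ u
  eval≡evalN5 (var v)  = refl
  eval≡evalN5 (u ∨ᵗ w) = cong₂ _⊔₅_ (eval≡evalN5 u) (eval≡evalN5 w)
  eval≡evalN5 (u ∧ᵗ w) = cong₂ _⊓₅_ (eval≡evalN5 u) (eval≡evalN5 w)

record IsHom₅ (h : N5 → N5) : Set where
  field
    ⊔-homo : Homomorphic₂ h _⊔₅_ _⊔₅_
    ⊓-homo : Homomorphic₂ h _⊓₅_ _⊓₅_

eval-hom : ∀ {X : Set} {h} → IsHom₅ h → {g g' : X → N5} → (∀ v → h (g v) ≡ g' v) →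
           ∀ t → h (eval pentagon g t) ≡ eval pentagon g' t
eval-hom hom h∘g≗g' (var v)  = h∘g≗g' v
eval-hom hom {g} h∘g≗g' (s ∨ᵗ t) =
  trans (IsHom₅.⊔-homo hom (eval pentagon g s) (eval pentagon g t))
        (cong₂ _⊔₅_ (eval-hom hom h∘g≗g' s) (eval-hom hom h∘g≗g' t))
eval-hom hom {g} h∘g≗g' (s ∧ᵗ t) =
  trans (IsHom₅.⊓-homo hom (eval pentagon g s) (eval pentagon g t))
        (cong₂ _⊓₅_ (eval-hom hom h∘g≗g' s) (eval-hom hom h∘g≗g' t))

-- Two homomorphisms of N5 onto the chain o < x: χx sends the prime filter
-- {x, y, i} to x and the rest to o; χz does the same for the filter {z, i}.
χx : N5 → N5
χx o = o
χx x = x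
χx y = x
χx z = o
χx i = x

χz : N5 → N5
χz o = o
χz x = o
χz y = o
χz z = x
χz i = x

χx-hom : IsHom₅ χx
χx-hom = record
  { ⊔-homo = from-yes (∀₅? λ p → ∀₅? λ q → χx (p ⊔₅ q) ≟₅ (χx p ⊔₅ χx q))
  ; ⊓-homo = from-yes (∀₅? λ p → ∀₅? λ q → χx (p ⊓₅ q) ≟₅ (χx p ⊓₅ χx q)) }

χz-hom : IsHom₅ χz
χz-hom = record
  { ⊔-homo = from-yes (∀₅? λ p → ∀₅? λ q → χz (p ⊔₅ q) ≟₅ (χz p ⊔₅ χz q))
  ; ⊓-homo = from-yes (∀₅? λ p → ∀₅? λ q → χz (p ⊓₅ q) ≟₅ (χz p ⊓₅ χz q)) }

Balanced : N5 → N5 → N5 → N5 → N5 → Set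
Balanced s γ δ α β = ((s ⊔₅ γ) ⊓₅ (s ⊔₅ δ)) ≡ ((s ⊓₅ α) ⊔₅ (s ⊓₅ β))

balanced-swap : ∀ {s γ δ α β} → Balanced s γ δ α β → Balanced s δ γ β α
balanced-swap {s} {γ} {δ} {α} {β} eq
  rewrite ⊓-comm₅ (s ⊔₅ δ) (s ⊔₅ γ) | ⊔-comm₅ (s ⊓₅ β) (s ⊓₅ α) = eq

data Phase : Set where
  below at above : Phase

phase : ℕ → ℕ → Phase
phase zero    zero    = at
phase zero    (suc n) = above
phase (suc k) zero    = below
phase (suc k) (suc n) = phase k n

data Step : Phase → Phase → Set where
  stay-below : Step below below
  arrive     : Step below at
  leave      : Step at above
  stay-above : Step above above

phase-step : ∀ k n → Step (phase k n) (phase k (suc n))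
phase-step zero          zero    = leave
phase-step zero          (suc n) = stay-above
phase-step (suc zero)    zero    = arrive
phase-step (suc (suc k)) zero    = stay-below
phase-step (suc k)       (suc n) = phase-step k n

phase-below : ∀ {k n} → n < k → phase k n ≡ below
phase-below {suc k} {zero}  _         = refl
phase-below {suc k} {suc n} (s≤s n<k) = phase-below n<k

data Reached : Phase → Set where
  at-threshold   : Reached at
  past-threshold : Reached above

phase-reached : ∀ {k n} → k ≤ n → Reached (phase k n)
phase-reached {zero} {zero}  _ = at-threshold
phase-reached {zero} {suc n} _ = past-threshold
phase-reached (s≤s k≤n)        = phase-reached k≤n

fromThreshold : N5 → Phase → N5
fromThreshold v below = o
fromThreshold v at    = v
fromThreshold v above = v

pastThreshold : N5 → Phase → N5
pastThreshold v below = o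
pastThreshold v at    = o
pastThreshold v above = v

fromThreshold-reached : ∀ {p} v → Reached p → fromThreshold v p ≡ v
fromThreshold-reached v at-threshold   = refl
fromThreshold-reached v past-threshold = refl

pastThreshold-shift : ∀ v k n → pastThreshold v (phase k n) ≡ fromThreshold v (phase (suc k) n)
pastThreshold-shift v zero    zero          = refl
pastThreshold-shift v zero    (suc zero)    = refl
pastThreshold-shift v zero    (suc (suc n)) = refl
pastThreshold-shift v (suc k) zero          = refl
pastThreshold-shift v (suc k) (suc n)       = pastThreshold-shift v k n

record Scheme : Set where
  field
    α β : Phase → N5
    γ δ : N5

record Admissible (sch : Scheme) : Set where
  open Scheme sch
  field
    meet-bound : ∀ p → (γ ⊓₅ δ) ≤₅ (α p ⊔₅ β p)
    step-bound : ∀ {p q} → Step p q →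
      (α p ≤₅ α q) × (β p ≤₅ β q) ×
      ((((γ ⊔₅ α p) ⊔₅ β p) ⊓₅ ((δ ⊔₅ α p) ⊔₅ β p)) ≤₅ (α q ⊔₅ β q))

module _ {m : ℕ} where

  assign : ℕ → Scheme → Gen m → N5
  assign k sch (a j) = Scheme.α sch (phase k (toℕ j))
  assign k sch (b j) = Scheme.β sch (phase k (toℕ j))
  assign k sch c     = Scheme.γ sch
  assign k sch d     = Scheme.δ sch

  consecutive : (C : Phase → Phase → Set) → (∀ {p q} → Step p q → C p q) →
                ∀ k (j : Fin m) → C (phase k (toℕ (inject₁ j))) (phase k (toℕ (fsuc j)))
  consecutive C step k j rewrite toℕ-inject₁ j = step (phase-step k (toℕ j))

  assign-valid : ∀ {sch} → Admissible sch → ∀ k → Relations m pentagon (assign k sch)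
  assign-valid {sch} adm k =
    consecutive _ (proj₁ ∘ step-bound) k ,
    consecutive _ (proj₁ ∘ proj₂ ∘ step-bound) k ,
    meet-bound (phase k 0) ,
    consecutive _ (proj₂ ∘ proj₂ ∘ step-bound) k
    where open Admissible adm

  swapGen : Gen m → Gen m
  swapGen (a j) = b j
  swapGen (b j) = a j
  swapGen c     = d
  swapGen d     = c

  swap-valid : ∀ {g} → Relations m pentagon g → Relations m pentagon (g ∘ swapGen)
  swap-valid {g} (a-chain , b-chain , meet , join) =
    b-chain , a-chain , swapped-meet , swapped-join
    where
    swapped-meet : (g d ⊓₅ g c) ≤₅ (g (b fzero) ⊔₅ g (a fzero))
    swapped-meet rewrite ⊓-comm₅ (g d) (g c) | ⊔-comm₅ (g (b fzero)) (g (a fzero)) = meet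
    swapped-join : ∀ k →
      ((((g d ⊔₅ g (b (inject₁ k))) ⊔₅ g (a (inject₁ k))) ⊓₅ ((g c ⊔₅ g (b (inject₁ k))) ⊔₅ g (a (inject₁ k))))
        ≤₅ (g (b (fsuc k)) ⊔₅ g (a (fsuc k))))
    swapped-join k
      rewrite ⊔-swapʳ₅ (g d) (g (b (inject₁ k))) (g (a (inject₁ k)))
            | ⊔-swapʳ₅ (g c) (g (b (inject₁ k))) (g (a (inject₁ k)))
            | ⊓-comm₅ ((g d ⊔₅ g (a (inject₁ k))) ⊔₅ g (b (inject₁ k)))
                      ((g c ⊔₅ g (a (inject₁ k))) ⊔₅ g (b (inject₁ k)))
            | ⊔-comm₅ (g (b (fsuc k))) (g (a (fsuc k))) = join k

data Side : Set where
  left right : Side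

flip : Side → Side
flip left  = right
flip right = left

orient : ∀ {m} → Side → Gen m → Gen m
orient left  v = v
orient right v = swapGen v

swap-orient : ∀ {m} side (v : Gen m) → swapGen (orient side v) ≡ orient (flip side) v
swap-orient left  v     = refl
swap-orient right (a j) = refl
swap-orient right (b j) = refl
swap-orient right c     = refl
swap-orient right d     = refl

T : Scheme
T = record { α = fromThreshold x ; β = λ _ → o ; γ = x ; δ = o }

S : Scheme
S = record { α = fromThreshold x ; β = pastThreshold z ; γ = y ; δ = z }

G : Scheme
G = record { α = λ _ → x ; β = λ _ → z ; γ = y ; δ = i }

T-admissible : Admissible T
T-admissible = record
  { meet-bound = λ _ → refl
  ; step-bound = λ { stay-below → refl , refl , refl ; arrive → refl , refl , refl
                   ; leave → refl , refl , refl ; stay-above → refl , refl , refl } }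

S-admissible : Admissible S
S-admissible = record
  { meet-bound = λ _ → refl
  ; step-bound = λ { stay-below → refl , refl , refl ; arrive → refl , refl , refl
                   ; leave → refl , refl , refl ; stay-above → refl , refl , refl } }

G-admissible : Admissible G
G-admissible = record { meet-bound = λ _ → refl ; step-bound = λ _ → refl , refl , refl }

χx-S : ∀ {m} k (v : Gen m) → χx (assign k S v) ≡ assign k T v
χx-S k (a j) = χx-from (phase k (toℕ j))
  where
  χx-from : ∀ p → χx (fromThreshold x p) ≡ fromThreshold x p
  χx-from below = refl
  χx-from at    = refl
  χx-from above = refl
χx-S k (b j) = χx-past (phase k (toℕ j))
  where
  χx-past : ∀ p → χx (pastThreshold z p) ≡ o
  χx-past below = refl
  χx-past at    = refl
  χx-past above = refl
χx-S k c = refl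
χx-S k d = refl

χz-S : ∀ {m} k (v : Gen m) → χz (assign k S v) ≡ assign (suc k) T (swapGen v)
χz-S k (a j) = χz-from (phase k (toℕ j))
  where
  χz-from : ∀ p → χz (fromThreshold x p) ≡ o
  χz-from below = refl
  χz-from at    = refl
  χz-from above = refl
χz-S k (b j) = trans (χz-past (phase k (toℕ j))) (pastThreshold-shift x k (toℕ j))
  where
  χz-past : ∀ p → χz (pastThreshold z p) ≡ pastThreshold x p
  χz-past below = refl
  χz-past at    = refl
  χz-past above = refl
χz-S k c = refl
χz-S k d = refl

χz-G : ∀ {m} (v : Gen m) → χz (assign 0 G v) ≡ assign 0 T (swapGen v)
χz-G (a j) = refl
χz-G (b j) = sym (fromThreshold-reached x (phase-reached {n = toℕ j} z≤n))
χz-G c     = refl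
χz-G d     = refl

balanced-T : ∀ {s} → Balanced s x o o o → s ≡ o
balanced-T {o} _ = refl
balanced-T {x} ()
balanced-T {y} ()
balanced-T {z} ()
balanced-T {i} ()

balanced-S : ∀ {s p} → Reached p → χz s ≡ o →
             Balanced s y z (fromThreshold x p) (pastThreshold z p) → s ≡ o
balanced-S {o} _              _  _  = refl
balanced-S {x} at-threshold   _  ()
balanced-S {x} past-threshold _  ()
balanced-S {y} at-threshold   _  ()
balanced-S {y} past-threshold _  ()
balanced-S {z} _              () _
balanced-S {i} _              () _

balanced-G : ∀ {s} → Balanced s y i x z → s ≡ i
balanced-G {o} ()
balanced-G {x} ()
balanced-G {y} ()
balanced-G {z} ()
balanced-G {i} _ = refl

module Descent (m : ℕ) (f : Term (Gen m))
  (solves : EqInF m ((f ∨ᵗ var c) ∧ᵗ (f ∨ᵗ var d))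
                    ((f ∧ᵗ var (a (fromℕ m))) ∨ᵗ (f ∧ᵗ var (b (fromℕ m))))) where

  value : (Gen m → N5) → N5
  value g = eval pentagon g f

  top : ℕ
  top = toℕ (fromℕ m)

  balanced : ∀ side {sch} → Admissible sch → ∀ k →
    let open Scheme sch in
    Balanced (value (assign k sch ∘ orient side)) γ δ (α (phase k top)) (β (phase k top))
  balanced left  {sch} adm k = solves pentagon pentagon∈𝒩₅ (assign k sch) (assign-valid adm k)
  balanced right {sch} adm k =
    balanced-swap {value (assign k sch ∘ swapGen)} {δ} {γ} {β (phase k top)} {α (phase k top)}
      (solves pentagon pentagon∈𝒩₅ (assign k sch ∘ swapGen)
              (swap-valid {g = assign k sch} (assign-valid adm k)))
    where open Scheme sch

  Vanishes : ℕ → Set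
  Vanishes k = ∀ side → value (assign k T ∘ orient side) ≡ o

  -- At threshold m+1, T is o on aₘ, so the equation forces the value o.
  vanishes-top : Vanishes (suc m)
  vanishes-top side = balanced-T (subst (λ p → Balanced t x o (fromThreshold x p) o) top-below
                                        (balanced side T-admissible (suc m)))
    where
    t : N5
    t = value (assign (suc m) T ∘ orient side)
    top-below : phase (suc m) top ≡ below
    top-below = phase-below (subst (_< suc m) (sym (toℕ-fromℕ m)) (n<1+n m))

  -- The value at S k is o, as χz maps it to the value at the other T (k+1);
  -- χx maps it to the value at T k.
  vanishes-step : ∀ {k} → k ≤ m → Vanishes (suc k) → Vanishes k
  vanishes-step {k} k≤m ih side = begin
    value (assign k T ∘ orient side)          ≡⟨ sym (eval-hom χx-hom (χx-S k ∘ orient side) f) ⟩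
    χx (value (assign k S ∘ orient side))     ≡⟨ cong χx value-S ⟩
    o                                         ∎
    where
    open ≡-Reasoning
    χz-value-S : χz (value (assign k S ∘ orient side)) ≡ o
    χz-value-S = trans (eval-hom χz-hom (λ v → trans (χz-S k (orient side v))
                                                     (cong (assign (suc k) T) (swap-orient side v))) f)
                       (ih (flip side))
    value-S : value (assign k S ∘ orient side) ≡ o
    value-S = balanced-S (phase-reached (subst (k ≤_) (sym (toℕ-fromℕ m)) k≤m)) χz-value-S
                         (balanced side S-admissible k)

  -- Downward induction from the top threshold, by the gap to it.
  vanishes : ∀ gap {k} → gap + k ≡ suc m → Vanishes k
  vanishes zero      refl = vanishes-top
  vanishes (suc gap) {k} e =
    vanishes-step (subst (k ≤_) (suc-injective e) (m≤n+m k gap)) (vanishes gap (trans (+-suc gap k) e))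

  -- G forces the value i, and χz maps G onto the swapped T 0, so the value
  -- there is χz i = x.
  value-T₀ : value (assign 0 T ∘ orient right) ≡ x
  value-T₀ = trans (sym (eval-hom χz-hom χz-G f)) (cong χz (balanced-G (balanced left G-admissible 0)))

lemma5p3 : (m : ℕ) (f : Term (Gen m)) →
    ¬ EqInF m ((f ∨ᵗ var c) ∧ᵗ (f ∨ᵗ var d))
              ((f ∧ᵗ var (a (fromℕ m))) ∨ᵗ (f ∧ᵗ var (b (fromℕ m))))
lemma5p3 m f solves = x≢o (trans (sym value-T₀) (vanishes (suc m) (+-identityʳ (suc m)) right))
  where
  open Descent m f solves
  x≢o : x ≢ o
  x≢o ()
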